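{- The 3-caterpillar $F_1$ is not line $[B,A]$-nice, i.e. Bob has a winning strategy in the $[B,A]$-edge colouring game on $F_1$ with $3$ colours.
   Context: The 3-caterpillar $F_1$ is the tree with vertices $v,u,w_1,w_2,a_1,a_2,b_1,b_2$ and edges $vu,vw_1,vw_2,w_1a_1,w_1a_2,w_2b_1,w_2b_2$; the maximum number of pairwise adjacent edges of $F_1$ is $3$. In the $[B,A]$-edge colouring game with $k$ colours, Bob and Alice alternately colour a previously uncoloured edge with one of $k$ colours so that edges sharing an endpoint get distinct colours; Bob moves first; Alice (only) may skip any of her moves. The game ends when no move is possible; Alice wins iff all edges are coloured. A graph $G$ is line $[B,A]$-nice if the least $k$ for which Alice has a winning strategy equals the maximum number of pairwise adjacent edges of $G$. -}

module Defs where

open import Data.Nat using (ℕ)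
open import Data.Fin using (Fin; zero; suc; _≟_; #_)
open import Data.Maybe using (Maybe; just; nothing)
open import Data.Product using (Σ; _×_; _,_; proj₁; proj₂)
open import Data.Sum using (_⊎_)
open import Relation.Nullary using (¬_; yes; no)
open import Relation.Binary.PropositionalEquality using (_≡_; _≢_)

record Graph : Set where
  field
    nV : ℕ
    nE : ℕ
    ends : Fin nE → Fin nV × Fin nV

open Graph public

ShareEnd : (G : Graph) → Fin (nE G) → Fin (nE G) → Set
ShareEnd G e f =
  (proj₁ (ends G e) ≡ proj₁ (ends G f)) ⊎ (proj₁ (ends G e) ≡ proj₂ (ends G f)) ⊎
  (proj₂ (ends G e) ≡ proj₁ (ends G f)) ⊎ (proj₂ (ends G e) ≡ proj₂ (ends G f))

Adjacent : (G : Graph) → Fin (nE G) → Fin (nE G) → Set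
Adjacent G e f = (e ≢ f) × ShareEnd G e f

Colouring : Graph → ℕ → Set
Colouring G k = Fin (nE G) → Maybe (Fin k)

Legal : (G : Graph) (k : ℕ) → Colouring G k → Fin (nE G) → Fin k → Set
Legal G k s e c = (s e ≡ nothing) × (∀ f → Adjacent G e f → s f ≢ just c)

update : (G : Graph) (k : ℕ) → Colouring G k → Fin (nE G) → Fin k → Colouring G k
update G k s e c f with e ≟ f
... | yes _ = just c
... | no  _ = s f

HasMove : (G : Graph) (k : ℕ) → Colouring G k → Set
HasMove G k s = Σ (Fin (nE G)) λ e → Σ (Fin k) λ c → Legal G k s e c

Complete : (G : Graph) (k : ℕ) → Colouring G k → Set
Complete G k s = ∀ e → Σ (Fin k) λ c → s e ≡ just c

-- The game ends when no move is possible; Alice wins iff all edges are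
-- coloured, so Bob wins at a terminal position iff it is not complete.
BobWinsEnd : (G : Graph) (k : ℕ) → Colouring G k → Set
BobWinsEnd G k s = ¬ HasMove G k s × ¬ Complete G k s

-- Bob has a winning strategy from position s (inductively, i.e. a finite
-- strategy tree).  AliceTurn: Alice is to move;
-- Alice may colour any legal edge or skip (only when a move is possible,
-- since otherwise the game has already ended).
mutual
  data BobWinsBobTurn (G : Graph) (k : ℕ) (s : Colouring G k) : Set where
    ended : BobWinsEnd G k s → BobWinsBobTurn G k s
    move  : (e : Fin (nE G)) (c : Fin k) → Legal G k s e c →
            BobWinsAliceTurn G k (update G k s e c) → BobWinsBobTurn G k s

  data BobWinsAliceTurn (G : Graph) (k : ℕ) (s : Colouring G k) : Set where
    ended  : BobWinsEnd G k s → BobWinsAliceTurn G k s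
    answer : HasMove G k s →
             BobWinsBobTurn G k s →   -- Alice skips
             (∀ e c → Legal G k s e c → BobWinsBobTurn G k (update G k s e c)) →
             BobWinsAliceTurn G k s

empty : (G : Graph) (k : ℕ) → Colouring G k
empty G k _ = nothing

BobWins : Graph → ℕ → Set
BobWins G k = BobWinsBobTurn G k (empty G k)

-- The 3-caterpillar F₁.  Vertices: v=0, u=1, w₁=2, w₂=3, a₁=4, a₂=5, b₁=6, b₂=7.
-- Edges: vu, vw₁, vw₂, w₁a₁, w₁a₂, w₂b₁, w₂b₂.
F₁-ends : Fin 7 → Fin 8 × Fin 8
F₁-ends zero = (# 0 , # 1)
F₁-ends (suc zero) = (# 0 , # 2)
F₁-ends (suc (suc zero)) = (# 0 , # 3)
F₁-ends (suc (suc (suc zero))) = (# 2 , # 4)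
F₁-ends (suc (suc (suc (suc zero)))) = (# 2 , # 5)
F₁-ends (suc (suc (suc (suc (suc zero))))) = (# 3 , # 6)
F₁-ends (suc (suc (suc (suc (suc (suc zero)))))) = (# 3 , # 7)

F₁ : Graph
F₁ = record { nV = 8 ; nE = 7 ; ends = F₁-ends }

-- The game tree of F₁ with 3 colours is small enough to search exhaustively.  The search
-- returns Bob's strategy tree itself (an inhabitant of BobWinsBobTurn) instead of a boolean,
-- so it needs no soundness proof: the theorem is the search result, evaluated to 'just'
-- during type checking.  Each Bob move colours an edge, so nE G rounds of fuel suffice.

module Submission where

open import Defs
open import Data.Nat using (ℕ; zero; suc)
open import Data.Fin using (Fin; _≟_; #_)
open import Data.Fin.Properties using (any?; all?; sequence)
open import Data.List using (List; []; _∷_; allFin; cartesianProduct; mapMaybe; head)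
open import Data.Maybe using (Maybe; just; nothing; map; ap; _<∣>_; from-just)
open import Data.Maybe.Effectful using (applicative)
open import Data.Maybe.Properties using (≡-dec)
open import Data.Product using (_×_; _,_; proj₁; proj₂)
open import Function using (const)
open import Relation.Nullary using (Dec; yes; no; ¬?; contradiction)
open import Relation.Nullary.Decidable using (_×-dec_; _⊎-dec_; _→-dec_; dec⇒maybe)

module Decide (G : Graph) (k : ℕ) where

  shareEnd? : ∀ e f → Dec (ShareEnd G e f)
  shareEnd? e f =
    (proj₁ (ends G e) ≟ proj₁ (ends G f)) ⊎-dec (proj₁ (ends G e) ≟ proj₂ (ends G f)) ⊎-dec
    (proj₂ (ends G e) ≟ proj₁ (ends G f)) ⊎-dec (proj₂ (ends G e) ≟ proj₂ (ends G f))

  adjacent? : ∀ e f → Dec (Adjacent G e f)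
  adjacent? e f = ¬? (e ≟ f) ×-dec shareEnd? e f

  legal? : ∀ s e c → Dec (Legal G k s e c)
  legal? s e c =
    ≡-dec _≟_ (s e) nothing ×-dec all? λ f → adjacent? e f →-dec ¬? (≡-dec _≟_ (s f) (just c))

  hasMove? : ∀ s → Dec (HasMove G k s)
  hasMove? s = any? λ e → any? λ c → legal? s e c

  complete? : ∀ s → Dec (Complete G k s)
  complete? s = all? λ e → any? λ c → ≡-dec _≟_ (s e) (just c)

  bobWinsEnd? : ∀ s → Dec (BobWinsEnd G k s)
  bobWinsEnd? s = ¬? (hasMove? s) ×-dec ¬? (complete? s)

module Search (G : Graph) (k : ℕ) (edgeOrder : List (Fin (nE G))) where

  open Decide G k

  mutual
    searchBobTurn : ℕ → ∀ s → Maybe (BobWinsBobTurn G k s)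
    searchBobTurn zero    s = map ended (dec⇒maybe (bobWinsEnd? s))
    searchBobTurn (suc n) s =
      head (mapMaybe tryMove (cartesianProduct edgeOrder (allFin k)))
        <∣> map ended (dec⇒maybe (bobWinsEnd? s))
      where
      tryMove : Fin (nE G) × Fin k → Maybe (BobWinsBobTurn G k s)
      tryMove (e , c) with legal? s e c
      ... | yes legal = map (move e c legal) (searchAliceTurn n (update G k s e c))
      ... | no _      = nothing

    searchAliceTurn : ℕ → ∀ s → Maybe (BobWinsAliceTurn G k s)
    searchAliceTurn n s with hasMove? s
    ... | no noMove =
      map (λ incomplete → ended (noMove , incomplete)) (dec⇒maybe (¬? (complete? s)))
    ... | yes has =
      ap (map (answer has) (searchBobTurn n s))
         (sequence applicative λ e → sequence applicative λ c → reply e c)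
      where
      reply : ∀ e c → Maybe (Legal G k s e c → BobWinsBobTurn G k (update G k s e c))
      reply e c with legal? s e c
      ... | yes _     = map const (searchBobTurn n (update G k s e c))
      ... | no ¬legal = just λ legal → contradiction legal ¬legal

-- Pendant edges (vu, then the four leaf edges) before the inner edges vw₁, vw₂: with this
-- order the search visits about a third of the positions of the natural order.
open Search F₁ 3 (# 0 ∷ # 3 ∷ # 4 ∷ # 5 ∷ # 6 ∷ # 1 ∷ # 2 ∷ [])

lemma41 : BobWins F₁ 3
lemma41 = from-just (searchBobTurn (nE F₁) (empty F₁ 3))
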